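{- Let $c_1>0$. Let $\mathcal{F}\subset\mathcal{P}([n])$ with $\mu(\mathcal{F})=\mu$, $\mu_i^-(\mathcal{F})\le\mu_i^+(\mathcal{F})$ for all $i\in[n]$, and $I[\mathcal{F}]\le I[\mathcal{L}_\mu]+c_1$. Then for each $i\in[n]$, $\mathcal{S}_{\varnothing\{i\}}(\mathcal{F})$ is a $\frac{c_1}{2}$-small modification of $\mathcal{F}$.
   Context: For $\mathcal{F}\subset\mathcal{P}([n])$, $\mu(\mathcal{F})=|\mathcal{F}|/2^n$; $\mathrm{Inf}_i[\mathcal{F}]$ is the probability, for uniform $A\in\mathcal{P}([n])$, that exactly one of $A$, $A\Delta\{i\}$ lies in $\mathcal{F}$; $I[\mathcal{F}]=\sum_i\mathrm{Inf}_i[\mathcal{F}]$. $\mathcal{L}_\mu$ is the initial segment (largest sets) of measure $\mu$ of the lexicographic order on $\mathcal{P}([n])$ ($S>T$ iff $\min(S\Delta T)\in S$). $\mu_i^-(\mathcal{F})=|\{S\in\mathcal{F}:i\notin S\}|/2^{n-1}$, $\mu_i^+(\mathcal{F})=|\{S\in\mathcal{F}:i\in S\}|/2^{n-1}$. The monotonization operator $\mathcal{S}_{\varnothing\{i\}}$ replaces each $A\in\mathcal{F}$ with $i\notin A$ and $A\cup\{i\}\notin\mathcal{F}$ by $A\cup\{i\}$, leaving other members unchanged. $\mathcal{G}$ is an $s$-small modification of $\mathcal{F}$ if $\mu(\mathcal{G})=\mu(\mathcal{F})$, $I[\mathcal{G}]\le I[\mathcal{F}]$ and $\mu(\mathcal{F}\Delta\mathcal{G})\le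 s$. -}

module Defs where

open import Data.Bool using (Bool; true; false; _∧_; _∨_; _xor_; not; if_then_else_)
open import Data.Nat using (ℕ; zero; suc; _^_; _∸_; _<ᵇ_)
open import Data.Nat.Properties using (m^n≢0)
open import Data.Fin using (Fin; zero; suc)
open import Data.Vec using (Vec; []; _∷_; lookup; _[_]≔_)
open import Data.List using (List; []; _∷_; _++_; map; length; filter; foldr)
open import Data.Integer using (+_)
open import Data.Rational using (ℚ; _/_; _+_; 0ℚ)
open import Relation.Nullary.Decidable using (Dec; yes; no)
open import Relation.Binary.PropositionalEquality using (_≡_)
open import Data.Bool.Properties using (T?)

-- A subset of [n] = {1,…,n} is a characteristic vector; position (k : Fin n)
-- represents the element k+1.
Set' : ℕ → Set
Set' n = Vec Bool n

Family : ℕ → Set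
Family n = Set' n → Bool

allSets : (n : ℕ) → List (Set' n)
allSets zero = [] ∷ []
allSets (suc n) = map (false ∷_) (allSets n) ++ map (true ∷_) (allSets n)

count : ∀ {n} → (Set' n → Bool) → ℕ
count {n} p = length (filter (λ A → T? (p A)) (allSets n))

card : ∀ {n} → Family n → ℕ
card F = count F

_/2^_ : ℕ → ℕ → ℚ
k /2^ m = ((+ k) / (2 ^ m)) {{m^n≢0 2 m}}

μ : ∀ {n} → Family n → ℚ
μ {n} F = card F /2^ n

flip : ∀ {n} → Fin n → Set' n → Set' n
flip i A = A [ i ]≔ not (lookup A i)

insert : ∀ {n} → Fin n → Set' n → Set' n
insert i A = A [ i ]≔ true

remove : ∀ {n} → Fin n → Set' n → Set' n
remove i A = A [ i ]≔ false

Inf : ∀ {n} → Fin n → Family n → ℚ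
Inf {n} i F = count (λ A → F A xor F (flip i A)) /2^ n

allFin : (n : ℕ) → List (Fin n)
allFin zero = []
allFin (suc n) = zero ∷ map suc (allFin n)

I : ∀ {n} → Family n → ℚ
I {n} F = foldr (λ i q → Inf i F + q) 0ℚ (allFin n)

μ⁻ : ∀ {n} → Fin n → Family n → ℚ
μ⁻ {n} i F = count (λ S → F S ∧ not (lookup S i)) /2^ (n ∸ 1)

μ⁺ : ∀ {n} → Fin n → Family n → ℚ
μ⁺ {n} i F = count (λ S → F S ∧ lookup S i) /2^ (n ∸ 1)

_>lex_ : ∀ {n} → Set' n → Set' n → Bool
[] >lex [] = false
(true ∷ S) >lex (false ∷ T) = true
(false ∷ S) >lex (true ∷ T) = false
(true ∷ S) >lex (true ∷ T) = S >lex T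
(false ∷ S) >lex (false ∷ T) = S >lex T

-- The initial segment of the lex order (largest sets) consisting of k sets:
-- S belongs to it iff fewer than k sets are lex-larger than S.
-- L_μ for μ = k/2^n is  lexSeg n k.
lexSeg : (n : ℕ) → ℕ → Family n
lexSeg n k S = count (λ T → T >lex S) <ᵇ k

Lμ : ∀ {n} → Family n → Family n
Lμ {n} F = lexSeg n (card F)

S∅ : ∀ {n} → Fin n → Family n → Family n
S∅ i F B = if lookup B i then (F B ∨ F (remove i B)) else (F B ∧ F (insert i B))

_Δ_ : ∀ {n} → Family n → Family n → Family n
(F Δ G) A = F A xor G A

open import Data.Rational using (_≤_)
open import Data.Product using (_×_)

SmallMod : ∀ {n} → ℚ → Family n → Family n → Set
SmallMod s F G = (μ G ≡ μ F) × (I G ≤ I F) × (μ (F Δ G) ≤ s)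

module Submission where

-- Let ∂F = 2^n I[F] count the boundary pairs of F. Splitting the cube along i into the slices F⁻, F⁺
-- gives ∂F = ∂F⁻ + ∂F⁺ + 2|F⁻ Δ F⁺|. The monotonization replaces the slices by F⁻ ∩ F⁺ and F⁻ ∪ F⁺, which
-- keeps |F| and, the boundary being submodular, does not increase ∂F; it moves 2|F⁻ ∖ F⁺| sets.
-- Let g_n(k) be the boundary of the lex segment of size k. Harper's inequality g_n(|F|) ≤ ∂F follows by
-- induction from the merge bound g_{n+1}(a + b) + 2a ≤ g_n(a) + g_n(b) + 2b for a ≤ b ≤ 2^n, and the same
-- two facts applied to the slices, with |F⁻| ≤ |F⁺| (the hypothesis μ_i^- ≤ μ_i^+), give
-- g_n(|F|) + 2|F Δ S(F)| ≤ ∂F. Dividing by 2^n, μ(F Δ S(F)) ≤ (I[F] − I[L_μ]) / 2 ≤ c₁ / 2.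

open import Defs
open import Data.Bool using (Bool; true; false; _∧_; _∨_; _xor_; not)
open import Data.Bool.Properties using (T?; ∨-comm; ∧-identityʳ; ∧-zeroʳ; xor-comm)
open import Data.Fin using (Fin; zero; suc; punchIn)
open import Data.Vec using (Vec; []; _∷_; lookup; insertAt; _[_]≔_)
open import Data.Vec.Properties using (insertAt-lookup)
open import Data.List using (List; []; _∷_; map; length; filter; foldr)
open import Data.List.Properties using (filter-++; length-++)
open import Data.Product using (_,_)
open import Data.Sum using (inj₁; inj₂)
open import Function using (_∘_)
open import Relation.Binary.PropositionalEquality

module Combinatorics where

  open import Data.Nat
  open import Data.Nat.Properties
  open import Data.Nat.Tactic.RingSolver using (solve-∀)
  open import Relation.Nullary using (yes; no)
  open import Algebra.Properties.CommutativeMonoid.Sum +-0-commutativeMonoid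
    using (sum; sum-cong-≗; sum-remove; ∑-distrib-+)
  open import Algebra.Properties.CommutativeSemigroup +-commutativeSemigroup using (interchange; x∙yz≈y∙xz)

  -- Counting subsets of the cube

  ind : Bool → ℕ
  ind true = 1
  ind false = 0

  sumCube : ∀ {n} → (Set' n → ℕ) → ℕ
  sumCube {zero} f = f []
  sumCube {suc n} f = sumCube (f ∘ (false ∷_)) + sumCube (f ∘ (true ∷_))

  #_ : ∀ {n} → (Set' n → Bool) → ℕ
  # p = sumCube (ind ∘ p)

  sumCube-cong : ∀ {n} {f g : Set' n → ℕ} → (∀ A → f A ≡ g A) → sumCube f ≡ sumCube g
  sumCube-cong {zero} f≗g = f≗g []
  sumCube-cong {suc n} f≗g = cong₂ _+_ (sumCube-cong (f≗g ∘ (false ∷_))) (sumCube-cong (f≗g ∘ (true ∷_)))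

  sumCube-mono : ∀ {n} {f g : Set' n → ℕ} → (∀ A → f A ≤ g A) → sumCube f ≤ sumCube g
  sumCube-mono {zero} f≤g = f≤g []
  sumCube-mono {suc n} f≤g = +-mono-≤ (sumCube-mono (f≤g ∘ (false ∷_))) (sumCube-mono (f≤g ∘ (true ∷_)))

  sumCube-+ : ∀ {n} (f g : Set' n → ℕ) → sumCube (λ A → f A + g A) ≡ sumCube f + sumCube g
  sumCube-+ {zero} f g = refl
  sumCube-+ {suc n} f g =
    trans (cong₂ _+_ (sumCube-+ (f ∘ (false ∷_)) (g ∘ (false ∷_))) (sumCube-+ (f ∘ (true ∷_)) (g ∘ (true ∷_))))
    (interchange (sumCube (f ∘ (false ∷_))) (sumCube (g ∘ (false ∷_))) (sumCube (f ∘ (true ∷_))) (sumCube (g ∘ (true ∷_))))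

  sumCube-insertAt : ∀ {n} (i : Fin (suc n)) (f : Set' (suc n) → ℕ) →
    sumCube f ≡ sumCube (λ S → f (insertAt S i false)) + sumCube (λ S → f (insertAt S i true))
  sumCube-insertAt zero f = refl
  sumCube-insertAt {suc n} (suc i) f =
    trans (cong₂ _+_ (sumCube-insertAt i (f ∘ (false ∷_))) (sumCube-insertAt i (f ∘ (true ∷_))))
      (interchange (sumCube (λ S → f (false ∷ insertAt S i false))) (sumCube (λ S → f (false ∷ insertAt S i true)))
                   (sumCube (λ S → f (true ∷ insertAt S i false))) (sumCube (λ S → f (true ∷ insertAt S i true))))

  #-cong : ∀ {n} {p q : Set' n → Bool} → (∀ A → p A ≡ q A) → # p ≡ # q
  #-cong p≗q = sumCube-cong (cong ind ∘ p≗q)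

  #-+-mono : ∀ {n} (p q r s : Set' n → Bool) →
    (∀ A → ind (p A) + ind (q A) ≤ ind (r A) + ind (s A)) → # p + # q ≤ # r + # s
  #-+-mono p q r s pw = subst₂ _≤_ (sumCube-+ (ind ∘ p) (ind ∘ q)) (sumCube-+ (ind ∘ r) (ind ∘ s)) (sumCube-mono pw)

  #-+-cong : ∀ {n} (p q r s : Set' n → Bool) →
    (∀ A → ind (p A) + ind (q A) ≡ ind (r A) + ind (s A)) → # p + # q ≡ # r + # s
  #-+-cong p q r s pw = trans (sym (sumCube-+ (ind ∘ p) (ind ∘ q))) (trans (sumCube-cong pw) (sumCube-+ (ind ∘ r) (ind ∘ s)))

  #-empty : ∀ {n} → # (λ (_ : Set' n) → false) ≡ 0
  #-empty {zero} = refl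
  #-empty {suc n} = cong₂ _+_ (#-empty {n}) (#-empty {n})

  #-full : ∀ {n} → # (λ (_ : Set' n) → true) ≡ 2 ^ n
  #-full {zero} = refl
  #-full {suc n} = cong₂ _+_ (#-full {n}) (trans (#-full {n}) (sym (+-identityʳ (2 ^ n))))

  #-≤-2^ : ∀ {n} (p : Set' n → Bool) → # p ≤ 2 ^ n
  #-≤-2^ {n} p = subst (# p ≤_) (#-full {n}) (sumCube-mono (ind≤1 ∘ p))
    where
    ind≤1 : ∀ b → ind b ≤ 1
    ind≤1 true = ≤-refl
    ind≤1 false = z≤n

  length-filter-map : ∀ {A B : Set} (p : B → Bool) (g : A → B) (xs : List A) →
    length (filter (T? ∘ p) (map g xs)) ≡ length (filter (T? ∘ p ∘ g) xs)
  length-filter-map p g [] = refl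
  length-filter-map p g (x ∷ xs) with p (g x)
  ... | true = cong suc (length-filter-map p g xs)
  ... | false = length-filter-map p g xs

  count≡# : ∀ {n} (p : Set' n → Bool) → count p ≡ # p
  count≡# {zero} p with p []
  ... | true = refl
  ... | false = refl
  count≡# {suc n} p =
    trans (cong length (filter-++ (T? ∘ p) (map (false ∷_) (allSets n)) (map (true ∷_) (allSets n))))
    (trans (length-++ (filter (T? ∘ p) (map (false ∷_) (allSets n))))
    (cong₂ _+_ (trans (length-filter-map p (false ∷_) (allSets n)) (count≡# (p ∘ (false ∷_))))
               (trans (length-filter-map p (true ∷_) (allSets n)) (count≡# (p ∘ (true ∷_))))))

  -- Edge boundary and slices

  insertAt-[]≔ : ∀ {A : Set} {n} (S : Vec A n) (i : Fin (suc n)) (b c : A) → insertAt S i b [ i ]≔ c ≡ insertAt S i c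
  insertAt-[]≔ S zero b c = refl
  insertAt-[]≔ (x ∷ S) (suc i) b c = cong (x ∷_) (insertAt-[]≔ S i b c)

  flip-insertAt : ∀ {n} (S : Set' n) (i : Fin (suc n)) (b : Bool) → flip i (insertAt S i b) ≡ insertAt S i (not b)
  flip-insertAt S i b = trans (cong (λ c → insertAt S i b [ i ]≔ not c) (insertAt-lookup S i b)) (insertAt-[]≔ S i b (not b))

  flip-punchIn-insertAt : ∀ {n} (S : Set' n) (i : Fin (suc n)) (k : Fin n) (b : Bool) →
    flip (punchIn i k) (insertAt S i b) ≡ insertAt (flip k S) i b
  flip-punchIn-insertAt S zero k b = refl
  flip-punchIn-insertAt (x ∷ S) (suc i) zero b = refl
  flip-punchIn-insertAt (x ∷ S) (suc i) (suc k) b = cong (x ∷_) (flip-punchIn-insertAt S i k b)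

  boundaryAlong : ∀ {n} → Family n → Fin n → ℕ
  boundaryAlong F j = # (λ A → F A xor F (flip j A))

  boundary : ∀ {n} → Family n → ℕ
  boundary F = sum (boundaryAlong F)

  boundary-cong : ∀ {n} {F G : Family n} → (∀ A → F A ≡ G A) → boundary F ≡ boundary G
  boundary-cong F≗G = sum-cong-≗ (λ j → #-cong (λ A → cong₂ _xor_ (F≗G A) (F≗G (flip j A))))

  slice : ∀ {n} → Fin (suc n) → Bool → Family (suc n) → Family n
  slice i b F S = F (insertAt S i b)

  #-slice-false : ∀ {n} (i : Fin (suc n)) (F : Family (suc n)) → # (λ S → F S ∧ not (lookup S i)) ≡ # (slice i false F)
  #-slice-false {n} i F = begin
    # (λ S → F S ∧ not (lookup S i))
      ≡⟨ sumCube-insertAt i (λ S → ind (F S ∧ not (lookup S i))) ⟩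
    # (λ S → slice i false F S ∧ not (lookup (insertAt S i false) i))
      + # (λ S → slice i true F S ∧ not (lookup (insertAt S i true) i))
      ≡⟨ cong₂ _+_
           (#-cong (λ S → trans (cong (λ b → slice i false F S ∧ not b) (insertAt-lookup S i false)) (∧-identityʳ _)))
           (trans (#-cong (λ S → trans (cong (λ b → slice i true F S ∧ not b) (insertAt-lookup S i true)) (∧-zeroʳ _)))
                  (#-empty {n})) ⟩
    # (slice i false F) + 0
      ≡⟨ +-identityʳ _ ⟩
    # (slice i false F) ∎
    where open ≡-Reasoning

  #-slice-true : ∀ {n} (i : Fin (suc n)) (F : Family (suc n)) → # (λ S → F S ∧ lookup S i) ≡ # (slice i true F)
  #-slice-true {n} i F = begin
    # (λ S → F S ∧ lookup S i)
      ≡⟨ sumCube-insertAt i (λ S → ind (F S ∧ lookup S i)) ⟩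
    # (λ S → slice i false F S ∧ lookup (insertAt S i false) i)
      + # (λ S → slice i true F S ∧ lookup (insertAt S i true) i)
      ≡⟨ cong₂ _+_
           (trans (#-cong (λ S → trans (cong (slice i false F S ∧_) (insertAt-lookup S i false)) (∧-zeroʳ _)))
                  (#-empty {n}))
           (#-cong (λ S → trans (cong (slice i true F S ∧_) (insertAt-lookup S i true)) (∧-identityʳ _))) ⟩
    # (slice i true F) ∎
    where open ≡-Reasoning

  boundary-slices : ∀ {n} (i : Fin (suc n)) (F : Family (suc n)) →
    boundary F ≡ boundary (slice i false F) + boundary (slice i true F) + 2 * # (slice i false F Δ slice i true F)
  boundary-slices {n} i F = begin
    boundary F                                            ≡⟨ sum-remove {i = i} (boundaryAlong F) ⟩
    boundaryAlong F i + sum (boundaryAlong F ∘ punchIn i) ≡⟨ cong₂ _+_ across along ⟩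
    2 * # (F⁻ Δ F⁺) + (boundary F⁻ + boundary F⁺) ≡⟨ +-comm (2 * # (F⁻ Δ F⁺)) _ ⟩
    boundary F⁻ + boundary F⁺ + 2 * # (F⁻ Δ F⁺) ∎
    where
    open ≡-Reasoning
    F⁻ = slice i false F
    F⁺ = slice i true F
    across : boundaryAlong F i ≡ 2 * # (F⁻ Δ F⁺)
    across = begin
      boundaryAlong F i                       ≡⟨ sumCube-insertAt i (λ A → ind (F A xor F (flip i A))) ⟩
      # (λ S → F⁻ S xor F (flip i (insertAt S i false)))
        + # (λ S → F⁺ S xor F (flip i (insertAt S i true)))
        ≡⟨ cong₂ _+_ (#-cong (λ S → cong (λ A → F⁻ S xor F A) (flip-insertAt S i false)))
                     (#-cong (λ S → trans (cong (λ A → F⁺ S xor F A) (flip-insertAt S i true)) (xor-comm (F⁺ S) (F⁻ S)))) ⟩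
      # (F⁻ Δ F⁺) + # (F⁻ Δ F⁺)              ≡⟨ cong (# (F⁻ Δ F⁺) +_) (sym (+-identityʳ _)) ⟩
      2 * # (F⁻ Δ F⁺) ∎
    along : sum (boundaryAlong F ∘ punchIn i) ≡ boundary F⁻ + boundary F⁺
    along = trans (sum-cong-≗ (λ k → trans (sumCube-insertAt i (λ A → ind (F A xor F (flip (punchIn i k) A))))
                    (cong₂ _+_ (#-cong (λ S → cong (λ A → F⁻ S xor F A) (flip-punchIn-insertAt S i k false)))
                               (#-cong (λ S → cong (λ A → F⁺ S xor F A) (flip-punchIn-insertAt S i k true))))))
                  (∑-distrib-+ (boundaryAlong F⁻) (boundaryAlong F⁺))

  -- Lexicographic segments

  <ᵇ-mono : ∀ c {j k} → j ≤ k → (c <ᵇ j) ≡ true → (c <ᵇ k) ≡ true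
  <ᵇ-mono c {zero} z≤n ()
  <ᵇ-mono zero (s≤s j≤k) _ = refl
  <ᵇ-mono (suc c) (s≤s j≤k) c<j = <ᵇ-mono c j≤k c<j

  +-<ᵇ : ∀ c m k → (c + m <ᵇ k) ≡ (c <ᵇ k ∸ m)
  +-<ᵇ c zero k = cong (_<ᵇ k) (+-identityʳ c)
  +-<ᵇ c (suc m) zero = refl
  +-<ᵇ c (suc m) (suc k) = trans (cong (_<ᵇ suc k) (+-suc c m)) (+-<ᵇ c m k)

  lexSeg-true : ∀ n k S → lexSeg (suc n) k (true ∷ S) ≡ lexSeg n k S
  lexSeg-true n k S = cong (_<ᵇ k) (begin
    count (_>lex (true ∷ S))                        ≡⟨ count≡# (_>lex (true ∷ S)) ⟩
    # (λ (_ : Set' n) → false) + # (_>lex S)        ≡⟨ cong (_+ # (_>lex S)) (#-empty {n}) ⟩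
    # (_>lex S)                                     ≡⟨ count≡# (_>lex S) ⟨
    count (_>lex S)                                 ∎)
    where open ≡-Reasoning

  lexSeg-false : ∀ n k S → lexSeg (suc n) k (false ∷ S) ≡ lexSeg n (k ∸ 2 ^ n) S
  lexSeg-false n k S = trans (cong (_<ᵇ k) (begin
    count (_>lex (false ∷ S))                       ≡⟨ count≡# (_>lex (false ∷ S)) ⟩
    # (_>lex S) + # (λ (_ : Set' n) → true)         ≡⟨ cong₂ _+_ (sym (count≡# (_>lex S))) (#-full {n}) ⟩
    count (_>lex S) + 2 ^ n                         ∎))
    (+-<ᵇ (count (_>lex S)) (2 ^ n) k)
    where open ≡-Reasoning

  lexSeg-mono : ∀ n {j k} → j ≤ k → ∀ S → lexSeg n j S ≡ true → lexSeg n k S ≡ true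
  lexSeg-mono n j≤k S = <ᵇ-mono _ j≤k

  2^-suc : ∀ n → 2 ^ suc n ≡ 2 ^ n + 2 ^ n
  2^-suc n = cong (2 ^ n +_) (+-identityʳ (2 ^ n))

  ∸-⊓-+-⊓ : ∀ k m → (k ∸ m) ⊓ m + k ⊓ m ≡ k ⊓ (m + m)
  ∸-⊓-+-⊓ k m with ≤-total k m
  ... | inj₁ k≤m = begin
    (k ∸ m) ⊓ m + k ⊓ m ≡⟨ cong₂ (λ x y → x ⊓ m + y) (m≤n⇒m∸n≡0 k≤m) (m≤n⇒m⊓n≡m k≤m) ⟩
    k                   ≡⟨ m≤n⇒m⊓n≡m (≤-trans k≤m (m≤m+n m m)) ⟨
    k ⊓ (m + m)         ∎
    where open ≡-Reasoning
  ... | inj₂ m≤k with m≤n⇒∃[o]m+o≡n m≤k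
  ...   | r , refl = begin
    (m + r ∸ m) ⊓ m + (m + r) ⊓ m ≡⟨ cong₂ _+_ (cong (_⊓ m) (m+n∸m≡n m r)) (m≥n⇒m⊓n≡n (m≤m+n m r)) ⟩
    r ⊓ m + m                     ≡⟨ +-comm (r ⊓ m) m ⟩
    m + r ⊓ m                     ≡⟨ +-distribˡ-⊓ m r m ⟩
    (m + r) ⊓ (m + m)             ∎
    where open ≡-Reasoning

  #-lexSeg : ∀ n k → # (lexSeg n k) ≡ k ⊓ 2 ^ n
  #-lexSeg zero zero = refl
  #-lexSeg zero (suc k) = cong suc (sym (⊓-zeroʳ k))
  #-lexSeg (suc n) k = begin
    # (lexSeg (suc n) k)                          ≡⟨ cong₂ _+_ (#-cong (lexSeg-false n k)) (#-cong (lexSeg-true n k)) ⟩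
    # (lexSeg n (k ∸ 2 ^ n)) + # (lexSeg n k)     ≡⟨ cong₂ _+_ (#-lexSeg n (k ∸ 2 ^ n)) (#-lexSeg n k) ⟩
    (k ∸ 2 ^ n) ⊓ 2 ^ n + k ⊓ 2 ^ n               ≡⟨ ∸-⊓-+-⊓ k (2 ^ n) ⟩
    k ⊓ (2 ^ n + 2 ^ n)                           ≡⟨ cong (k ⊓_) (2^-suc n) ⟨
    k ⊓ 2 ^ suc n                                 ∎
    where open ≡-Reasoning

  #-Δ-⊆ : ∀ {n} (P Q : Family n) → (∀ A → P A ≡ true → Q A ≡ true) → # (P Δ Q) ≡ # Q ∸ # P
  #-Δ-⊆ {n} P Q P⊆Q = trans (sym (m+n∸n≡m (# (P Δ Q)) (# P))) (cong (_∸ # P) (begin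
    # (P Δ Q) + # P                    ≡⟨ #-+-cong (P Δ Q) P Q (λ _ → false) (λ A → pointwise (P A) (Q A) (P⊆Q A)) ⟩
    # Q + # (λ (_ : Set' n) → false)   ≡⟨ cong (# Q +_) (#-empty {n}) ⟩
    # Q + 0                            ≡⟨ +-identityʳ (# Q) ⟩
    # Q                                ∎))
    where
    open ≡-Reasoning
    pointwise : ∀ p q → (p ≡ true → q ≡ true) → ind (p xor q) + ind p ≡ ind q + ind false
    pointwise true q p⇒q rewrite p⇒q refl = refl
    pointwise false true _ = refl
    pointwise false false _ = refl

  -- boundary-slices at the first coordinate: the slices of lexSeg (suc n) k are lexSeg n (k ∸ 2^n) and lexSeg n k.
  lexBoundary : ℕ → ℕ → ℕ
  lexBoundary zero k = 0
  lexBoundary (suc n) k = lexBoundary n (k ∸ 2 ^ n) + lexBoundary n k + 2 * (k ⊓ 2 ^ n ∸ (k ∸ 2 ^ n) ⊓ 2 ^ n)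

  boundary-lexSeg : ∀ n k → boundary (lexSeg n k) ≡ lexBoundary n k
  boundary-lexSeg zero k = refl
  boundary-lexSeg (suc n) k = begin
    boundary (lexSeg (suc n) k)
      ≡⟨ boundary-slices zero (lexSeg (suc n) k) ⟩
    boundary L⁻ + boundary L⁺ + 2 * # (L⁻ Δ L⁺)
      ≡⟨ cong₂ (λ x y → x + y + 2 * # (L⁻ Δ L⁺)) (boundary-cong (lexSeg-false n k)) (boundary-cong (lexSeg-true n k)) ⟩
    boundary (lexSeg n (k ∸ 2 ^ n)) + boundary (lexSeg n k) + 2 * # (L⁻ Δ L⁺)
      ≡⟨ cong₂ (λ x y → x + y + 2 * # (L⁻ Δ L⁺)) (boundary-lexSeg n (k ∸ 2 ^ n)) (boundary-lexSeg n k) ⟩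
    lexBoundary n (k ∸ 2 ^ n) + lexBoundary n k + 2 * # (L⁻ Δ L⁺)
      ≡⟨ cong (λ x → lexBoundary n (k ∸ 2 ^ n) + lexBoundary n k + 2 * x) Δ-size ⟩
    lexBoundary (suc n) k ∎
    where
    open ≡-Reasoning
    L⁻ = slice zero false (lexSeg (suc n) k)
    L⁺ = slice zero true (lexSeg (suc n) k)
    Δ-size : # (L⁻ Δ L⁺) ≡ k ⊓ 2 ^ n ∸ (k ∸ 2 ^ n) ⊓ 2 ^ n
    Δ-size = begin
      # (L⁻ Δ L⁺)                                    ≡⟨ #-cong (λ S → cong₂ _xor_ (lexSeg-false n k S) (lexSeg-true n k S)) ⟩
      # (lexSeg n (k ∸ 2 ^ n) Δ lexSeg n k)          ≡⟨ #-Δ-⊆ _ _ (lexSeg-mono n (m∸n≤m k (2 ^ n))) ⟩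
      # (lexSeg n k) ∸ # (lexSeg n (k ∸ 2 ^ n))      ≡⟨ cong₂ _∸_ (#-lexSeg n k) (#-lexSeg n (k ∸ 2 ^ n)) ⟩
      k ⊓ 2 ^ n ∸ (k ∸ 2 ^ n) ⊓ 2 ^ n                ∎

  boundary-Lμ : ∀ {n} (F : Family n) → boundary (Lμ F) ≡ lexBoundary n (# F)
  boundary-Lμ {n} F = trans (boundary-lexSeg n (count F)) (cong (lexBoundary n) (count≡# F))

  lexBoundary-zero : ∀ n → lexBoundary n 0 ≡ 0
  lexBoundary-zero zero = refl
  lexBoundary-zero (suc n) rewrite 0∸n≡0 (2 ^ n) | lexBoundary-zero n = refl

  lexBoundary-full : ∀ n k → 2 ^ n ≤ k → lexBoundary n k ≡ 0
  lexBoundary-full zero k _ = refl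
  lexBoundary-full (suc n) k 2^suc≤k = begin
    lexBoundary n (k ∸ N) + lexBoundary n k + 2 * (k ⊓ N ∸ (k ∸ N) ⊓ N)
      ≡⟨ cong₂ (λ x y → x + y + 2 * (k ⊓ N ∸ (k ∸ N) ⊓ N)) (lexBoundary-full n (k ∸ N) N≤k∸N) (lexBoundary-full n k N≤k) ⟩
    2 * (k ⊓ N ∸ (k ∸ N) ⊓ N)
      ≡⟨ cong₂ (λ x y → 2 * (x ∸ y)) (m≥n⇒m⊓n≡n N≤k) (m≥n⇒m⊓n≡n N≤k∸N) ⟩
    2 * (N ∸ N)
      ≡⟨ cong (2 *_) (n∸n≡0 N) ⟩
    0 ∎
    where
    open ≡-Reasoning
    N = 2 ^ n
    N+N≤k : N + N ≤ k
    N+N≤k = subst (_≤ k) (2^-suc n) 2^suc≤k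
    N≤k : N ≤ k
    N≤k = ≤-trans (m≤m+n N N) N+N≤k
    N≤k∸N : N ≤ k ∸ N
    N≤k∸N = subst (_≤ k ∸ N) (m+n∸m≡n N N) (∸-monoˡ-≤ N N+N≤k)

  lexBoundary-lower : ∀ n k → k ≤ 2 ^ n → lexBoundary (suc n) k ≡ lexBoundary n k + 2 * k
  lexBoundary-lower n k k≤N rewrite m≤n⇒m∸n≡0 k≤N | lexBoundary-zero n | m≤n⇒m⊓n≡m k≤N = refl

  lexBoundary-upper : ∀ n y z → y + z ≡ 2 ^ n → lexBoundary (suc n) (2 ^ n + y) ≡ lexBoundary n y + 2 * z
  lexBoundary-upper n y z y+z≡N = begin
    lexBoundary n (N + y ∸ N) + lexBoundary n (N + y) + 2 * ((N + y) ⊓ N ∸ (N + y ∸ N) ⊓ N)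
      ≡⟨ cong₂ (λ x u → x + u + 2 * ((N + y) ⊓ N ∸ (N + y ∸ N) ⊓ N))
               (cong (lexBoundary n) (m+n∸m≡n N y)) (lexBoundary-full n (N + y) (m≤m+n N y)) ⟩
    lexBoundary n y + 0 + 2 * ((N + y) ⊓ N ∸ (N + y ∸ N) ⊓ N)
      ≡⟨ cong₂ (λ x u → x + 2 * (u ∸ (N + y ∸ N) ⊓ N)) (+-identityʳ (lexBoundary n y)) (m≥n⇒m⊓n≡n (m≤m+n N y)) ⟩
    lexBoundary n y + 2 * (N ∸ (N + y ∸ N) ⊓ N)
      ≡⟨ cong (λ x → lexBoundary n y + 2 * (N ∸ x ⊓ N)) (m+n∸m≡n N y) ⟩
    lexBoundary n y + 2 * (N ∸ y ⊓ N)
      ≡⟨ cong (λ x → lexBoundary n y + 2 * (N ∸ x)) (m≤n⇒m⊓n≡m y≤N) ⟩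
    lexBoundary n y + 2 * (N ∸ y)
      ≡⟨ cong (λ x → lexBoundary n y + 2 * (x ∸ y)) y+z≡N ⟨
    lexBoundary n y + 2 * (y + z ∸ y)
      ≡⟨ cong (λ x → lexBoundary n y + 2 * x) (m+n∸m≡n y z) ⟩
    lexBoundary n y + 2 * z ∎
    where
    open ≡-Reasoning
    N = 2 ^ n
    y≤N : y ≤ N
    y≤N = subst (y ≤_) y+z≡N (m≤m+n y z)

  lexBoundary-complement-step : ∀ n → (∀ y z → y + z ≡ 2 ^ n → lexBoundary n y ≡ lexBoundary n z) →
    ∀ y z → y ≤ 2 ^ n → y + z ≡ 2 ^ suc n → lexBoundary (suc n) y ≡ lexBoundary (suc n) z
  lexBoundary-complement-step n complement y z y≤N y+z≡ with m≤n⇒∃[o]m+o≡n y≤N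
  ... | w , y+w≡N = begin
    lexBoundary (suc n) y              ≡⟨ lexBoundary-lower n y y≤N ⟩
    lexBoundary n y + 2 * y            ≡⟨ cong (_+ 2 * y) (complement y w y+w≡N) ⟩
    lexBoundary n w + 2 * y            ≡⟨ lexBoundary-upper n w y (trans (+-comm w y) y+w≡N) ⟨
    lexBoundary (suc n) (2 ^ n + w)    ≡⟨ cong (lexBoundary (suc n)) z≡N+w ⟨
    lexBoundary (suc n) z              ∎
    where
    open ≡-Reasoning
    z≡N+w : z ≡ 2 ^ n + w
    z≡N+w = +-cancelˡ-≡ y z (2 ^ n + w) (begin
      y + z                ≡⟨ trans y+z≡ (2^-suc n) ⟩
      2 ^ n + 2 ^ n        ≡⟨ cong (_+ 2 ^ n) y+w≡N ⟨
      y + w + 2 ^ n        ≡⟨ trans (+-assoc y w (2 ^ n)) (cong (y +_) (+-comm w (2 ^ n))) ⟩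
      y + (2 ^ n + w)      ∎)

  -- The complement of an initial lex segment is, up to complementing every set, again one.
  lexBoundary-complement : ∀ n y z → y + z ≡ 2 ^ n → lexBoundary n y ≡ lexBoundary n z
  lexBoundary-complement zero y z _ = refl
  lexBoundary-complement (suc n) y z y+z≡ with ≤-total y (2 ^ n)
  ... | inj₁ y≤N = lexBoundary-complement-step n (lexBoundary-complement n) y z y≤N y+z≡
  ... | inj₂ N≤y = sym (lexBoundary-complement-step n (lexBoundary-complement n) z y z≤N (trans (+-comm z y) y+z≡))
    where
    z≤N : z ≤ 2 ^ n
    z≤N = +-cancelˡ-≤ (2 ^ n) z (2 ^ n) (subst (2 ^ n + z ≤_) (trans y+z≡ (2^-suc n)) (+-monoˡ-≤ z N≤y))

  -- Harper's edge-isoperimetric inequality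

  ≤-+-common : ∀ {l r x y} t → l ≡ x + t → r ≡ y + t → x ≤ y → l ≤ r
  ≤-+-common t refl refl x≤y = +-monoˡ-≤ t x≤y

  -- One inductive step of the merge inequality, for g = lexBoundary n, g₁ and g₂ the next two levels and N = 2^n.
  -- Since g₁, g₂ are symmetric about N and 2N, replacing (a, b) by (2N − b, 2N − a) lets us assume a + b ≤ 2N;
  -- then either b ≤ N (the inductive hypothesis) or b = N + y, which reduces to subadditivity of g.
  module MergeStep (N : ℕ) (g g₁ g₂ : ℕ → ℕ)
    (g₁-lower : ∀ k → k ≤ N → g₁ k ≡ g k + 2 * k)
    (g₁-upper : ∀ y z → y + z ≡ N → g₁ (N + y) ≡ g y + 2 * z)
    (g₂-lower : ∀ k → k ≤ N + N → g₂ k ≡ g₁ k + 2 * k)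
    (g₁-complement : ∀ y z → y + z ≡ N + N → g₁ y ≡ g₁ z)
    (g₂-complement : ∀ y z → y + z ≡ (N + N) + (N + N) → g₂ y ≡ g₂ z)
    (g-merge : ∀ a b → a ≤ b → b ≤ N → g₁ (a + b) + 2 * a ≤ g a + g b + 2 * b)
    where

    Merge : ℕ → ℕ → Set
    Merge a b = g₂ (a + b) + 2 * a ≤ g₁ a + g₁ b + 2 * b

    g-subadditive-ordered : ∀ a b → a ≤ b → a + b ≤ N → g (a + b) ≤ g a + g b
    g-subadditive-ordered a b a≤b a+b≤N = +-cancelʳ-≤ (2 * b) (g (a + b)) (g a + g b) (begin
      g (a + b) + 2 * b                     ≤⟨ +-monoʳ-≤ (g (a + b)) (≤-trans (*-monoʳ-≤ 2 (m≤n+m b a)) (m≤m+n _ _)) ⟩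
      g (a + b) + (2 * (a + b) + 2 * a)     ≡⟨ +-assoc (g (a + b)) _ _ ⟨
      g (a + b) + 2 * (a + b) + 2 * a       ≡⟨ cong (_+ 2 * a) (g₁-lower (a + b) a+b≤N) ⟨
      g₁ (a + b) + 2 * a                    ≤⟨ g-merge a b a≤b (≤-trans (m≤n+m b a) a+b≤N) ⟩
      g a + g b + 2 * b                     ∎)
      where open ≤-Reasoning

    g-subadditive : ∀ a b → a + b ≤ N → g (a + b) ≤ g a + g b
    g-subadditive a b a+b≤N with ≤-total a b
    ... | inj₁ a≤b = g-subadditive-ordered a b a≤b a+b≤N
    ... | inj₂ b≤a = subst₂ _≤_ (cong g (+-comm b a)) (+-comm (g b) (g a))
                       (g-subadditive-ordered b a b≤a (subst (_≤ N) (+-comm a b) a+b≤N))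

    merge-lower-half : ∀ a b → a ≤ b → b ≤ N → Merge a b
    merge-lower-half a b a≤b b≤N = ≤-+-common (2 * (a + b))
      (trans (cong (_+ 2 * a) (g₂-lower (a + b) (+-mono-≤ a≤N b≤N))) (lhs (g₁ (a + b)) a b))
      (trans (cong₂ (λ x y → x + y + 2 * b) (g₁-lower a a≤N) (g₁-lower b b≤N)) (rhs (g a) (g b) a b))
      (g-merge a b a≤b b≤N)
      where
      a≤N = ≤-trans a≤b b≤N
      lhs : ∀ G a b → G + 2 * (a + b) + 2 * a ≡ G + 2 * a + 2 * (a + b)
      lhs = solve-∀
      rhs : ∀ ga gb a b → ga + 2 * a + (gb + 2 * b) + 2 * b ≡ ga + gb + 2 * b + 2 * (a + b)
      rhs = solve-∀

    merge-straddle : ∀ a y r → a + y + r ≡ N → Merge a (N + y)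
    merge-straddle a y r a+y+r≡N = ≤-+-common (2 * r + 2 * (a + (N + y)) + 2 * a)
      (begin
        g₂ (a + (N + y)) + 2 * a
          ≡⟨ cong (_+ 2 * a) (g₂-lower (a + (N + y)) (subst (_≤ N + N) (sym shift) (+-monoʳ-≤ N a+y≤N))) ⟩
        g₁ (a + (N + y)) + 2 * (a + (N + y)) + 2 * a
          ≡⟨ cong (λ k → g₁ k + 2 * (a + (N + y)) + 2 * a) shift ⟩
        g₁ (N + (a + y)) + 2 * (a + (N + y)) + 2 * a
          ≡⟨ cong (λ x → x + 2 * (a + (N + y)) + 2 * a) (g₁-upper (a + y) r a+y+r≡N) ⟩
        g (a + y) + 2 * r + 2 * (a + (N + y)) + 2 * a
          ≡⟨ lhs (g (a + y)) (2 * r) (2 * (a + (N + y))) (2 * a) ⟩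
        g (a + y) + (2 * r + 2 * (a + (N + y)) + 2 * a) ∎)
      (begin
        g₁ a + g₁ (N + y) + 2 * (N + y)
          ≡⟨ cong₂ (λ x z → x + z + 2 * (N + y)) (g₁-lower a (≤-trans (m≤m+n a y) a+y≤N)) (g₁-upper y (a + r) y+a+r≡N) ⟩
        g a + 2 * a + (g y + 2 * (a + r)) + 2 * (N + y)
          ≡⟨ rhs (g a) (g y) a y r N ⟩
        g a + g y + (2 * r + 2 * (a + (N + y)) + 2 * a) ∎)
      (g-subadditive a y a+y≤N)
      where
      open ≡-Reasoning
      a+y≤N : a + y ≤ N
      a+y≤N = subst (a + y ≤_) a+y+r≡N (m≤m+n (a + y) r)
      y+a+r≡N : y + (a + r) ≡ N
      y+a+r≡N = trans (sym (+-assoc y a r)) (trans (cong (_+ r) (+-comm y a)) a+y+r≡N)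
      shift : a + (N + y) ≡ N + (a + y)
      shift = x∙yz≈y∙xz a N y
      lhs : ∀ G x y z → G + x + y + z ≡ G + (x + y + z)
      lhs = solve-∀
      rhs : ∀ ga gy a y r N → ga + 2 * a + (gy + 2 * (a + r)) + 2 * (N + y) ≡ ga + gy + (2 * r + 2 * (a + (N + y)) + 2 * a)
      rhs = solve-∀

    complement-sums : ∀ a b a' b' → a + a' ≡ N + N → b + b' ≡ N + N → a + b + (b' + a') ≡ (N + N) + (N + N)
    complement-sums a b a' b' a+a'≡ b+b'≡ =
      trans (cong (a + b +_) (+-comm b' a')) (trans (interchange a b a' b') (cong₂ _+_ a+a'≡ b+b'≡))

    merge-complement : ∀ a b a' b' → a + a' ≡ N + N → b + b' ≡ N + N → Merge b' a' → Merge a b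
    merge-complement a b a' b' a+a'≡ b+b'≡ merge' = +-cancelʳ-≤ (2 * (N + N)) _ _ (begin
      g₂ (a + b) + 2 * a + 2 * (N + N)       ≡⟨ cong₂ (λ x y → x + 2 * a + 2 * y)
                                                       (g₂-complement (a + b) (b' + a') (complement-sums a b a' b' a+a'≡ b+b'≡))
                                                       (sym b+b'≡) ⟩
      g₂ (b' + a') + 2 * a + 2 * (b + b')    ≡⟨ lhs (g₂ (b' + a')) a b b' ⟩
      g₂ (b' + a') + 2 * b' + (2 * a + 2 * b) ≤⟨ +-monoˡ-≤ (2 * a + 2 * b) merge' ⟩
      g₁ b' + g₁ a' + 2 * a' + (2 * a + 2 * b) ≡⟨ rhs (g₁ b') (g₁ a') a a' b ⟩
      g₁ a' + g₁ b' + 2 * b + 2 * (a + a')   ≡⟨ cong₂ (λ x y → x + y + 2 * b + 2 * (a + a'))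
                                                       (g₁-complement a' a (trans (+-comm a' a) a+a'≡))
                                                       (g₁-complement b' b (trans (+-comm b' b) b+b'≡)) ⟩
      g₁ a + g₁ b + 2 * b + 2 * (a + a')     ≡⟨ cong (λ x → g₁ a + g₁ b + 2 * b + 2 * x) a+a'≡ ⟩
      g₁ a + g₁ b + 2 * b + 2 * (N + N)      ∎)
      where
      open ≤-Reasoning
      lhs : ∀ G a b b' → G + 2 * a + 2 * (b + b') ≡ G + 2 * b' + (2 * a + 2 * b)
      lhs = solve-∀
      rhs : ∀ gb' ga' a a' b → gb' + ga' + 2 * a' + (2 * a + 2 * b) ≡ ga' + gb' + 2 * b + 2 * (a + a')
      rhs = solve-∀

    merge-lower : ∀ a b → a ≤ b → a + b ≤ N + N → Merge a b
    merge-lower a b a≤b a+b≤2N with ≤-total b N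
    ... | inj₁ b≤N = merge-lower-half a b a≤b b≤N
    ... | inj₂ N≤b with m≤n⇒∃[o]m+o≡n N≤b
    ...   | y , refl with m≤n⇒∃[o]m+o≡n (+-cancelˡ-≤ N (a + y) N (subst (_≤ N + N) (x∙yz≈y∙xz a N y) a+b≤2N))
    ...     | r , a+y+r≡N = merge-straddle a y r a+y+r≡N

    merge : ∀ a b → a ≤ b → b ≤ N + N → Merge a b
    merge a b a≤b b≤2N with a + b ≤? N + N
    ... | yes a+b≤2N = merge-lower a b a≤b a+b≤2N
    ... | no a+b≰2N with m≤n⇒∃[o]m+o≡n (≤-trans a≤b b≤2N) | m≤n⇒∃[o]m+o≡n b≤2N
    ...   | a' , a+a'≡ | b' , b+b'≡ =
      merge-complement a b a' b' a+a'≡ b+b'≡ (merge-lower b' a' b'≤a' b'+a'≤2N)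
      where
      b'≤a' : b' ≤ a'
      b'≤a' = +-cancelˡ-≤ a b' a' (subst (a + b' ≤_) (trans b+b'≡ (sym a+a'≡)) (+-monoˡ-≤ b' a≤b))
      b'+a'≤2N : b' + a' ≤ N + N
      b'+a'≤2N = +-cancelˡ-≤ (a + b) (b' + a') (N + N)
        (subst (_≤ a + b + (N + N)) (sym (complement-sums a b a' b' a+a'≡ b+b'≡)) (+-monoˡ-≤ (N + N) (<⇒≤ (≰⇒> a+b≰2N))))

  MergeBound : ℕ → Set
  MergeBound n = ∀ a b → a ≤ b → b ≤ 2 ^ n →
    lexBoundary (suc n) (a + b) + 2 * a ≤ lexBoundary n a + lexBoundary n b + 2 * b

  mergeBound : ∀ n → MergeBound n
  mergeBound zero zero zero _ _ = z≤n
  mergeBound zero zero (suc zero) _ _ = ≤-refl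
  mergeBound zero (suc zero) (suc zero) _ _ = ≤-refl
  mergeBound zero _ (suc (suc b)) _ (s≤s ())
  mergeBound zero (suc (suc a)) (suc zero) (s≤s ()) _
  mergeBound (suc n) a b a≤b b≤2^suc =
    MergeStep.merge (2 ^ n) (lexBoundary n) (lexBoundary (suc n)) (lexBoundary (suc (suc n)))
      (lexBoundary-lower n) (lexBoundary-upper n)
      (λ k k≤ → lexBoundary-lower (suc n) k (subst (k ≤_) (sym (2^-suc n)) k≤))
      (λ y z y+z≡ → lexBoundary-complement (suc n) y z (trans y+z≡ (sym (2^-suc n))))
      (λ y z y+z≡ → lexBoundary-complement (suc (suc n)) y z (trans y+z≡ (sym 2^suc-suc)))
      (mergeBound n) a b a≤b (subst (b ≤_) (2^-suc n) b≤2^suc)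
    where
    2^suc-suc : 2 ^ suc (suc n) ≡ (2 ^ n + 2 ^ n) + (2 ^ n + 2 ^ n)
    2^suc-suc = trans (2^-suc (suc n)) (cong₂ _+_ (2^-suc n) (2^-suc n))

  #-≤-+-Δ : ∀ {n} (P Q : Family n) → # Q ≤ # P + # (P Δ Q)
  #-≤-+-Δ {n} P Q = subst (_≤ # P + # (P Δ Q)) (trans (cong (# Q +_) (#-empty {n})) (+-identityʳ (# Q)))
    (#-+-mono Q (λ _ → false) P (P Δ Q) (λ A → pointwise (P A) (Q A)))
    where
    pointwise : ∀ p q → ind q + ind false ≤ ind p + ind (p xor q)
    pointwise true true = ≤-refl
    pointwise true false = z≤n
    pointwise false true = ≤-refl
    pointwise false false = z≤n

  lexBoundary-slices-≤ : ∀ {n} (P Q : Family n) s → # P ≤ # Q → # Q + s ≡ # P + # (P Δ Q) →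
    lexBoundary n (# P) ≤ boundary P → lexBoundary n (# Q) ≤ boundary Q →
    lexBoundary (suc n) (# P + # Q) + 2 * s ≤ boundary P + boundary Q + 2 * # (P Δ Q)
  lexBoundary-slices-≤ {n} P Q s P≤Q balance isoP isoQ = +-cancelʳ-≤ (2 * a) _ _ (begin
    lexBoundary (suc n) (a + b) + 2 * s + 2 * a    ≡⟨ +-assoc (lexBoundary (suc n) (a + b)) _ _ ⟩
    lexBoundary (suc n) (a + b) + (2 * s + 2 * a)  ≡⟨ cong (lexBoundary (suc n) (a + b) +_) (+-comm (2 * s) (2 * a)) ⟩
    lexBoundary (suc n) (a + b) + (2 * a + 2 * s)  ≡⟨ +-assoc (lexBoundary (suc n) (a + b)) _ _ ⟨
    lexBoundary (suc n) (a + b) + 2 * a + 2 * s    ≤⟨ +-monoˡ-≤ (2 * s) (mergeBound n a b P≤Q (#-≤-2^ Q)) ⟩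
    lexBoundary n a + lexBoundary n b + 2 * b + 2 * s ≤⟨ +-monoˡ-≤ (2 * s) (+-monoˡ-≤ (2 * b) (+-mono-≤ isoP isoQ)) ⟩
    boundary P + boundary Q + 2 * b + 2 * s        ≡⟨ +-assoc (boundary P + boundary Q) _ _ ⟩
    boundary P + boundary Q + (2 * b + 2 * s)      ≡⟨ cong (boundary P + boundary Q +_)
                                                          (trans (sym (*-distribˡ-+ 2 b s)) (cong (2 *_) balance)) ⟩
    boundary P + boundary Q + 2 * (a + X)          ≡⟨ cong (boundary P + boundary Q +_)
                                                          (trans (*-distribˡ-+ 2 a X) (+-comm (2 * a) (2 * X))) ⟩
    boundary P + boundary Q + (2 * X + 2 * a)      ≡⟨ +-assoc (boundary P + boundary Q) _ _ ⟨
    boundary P + boundary Q + 2 * X + 2 * a        ∎)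
    where
    open ≤-Reasoning
    a = # P
    b = # Q
    X = # (P Δ Q)

  edge-isoperimetric : ∀ {n} (F : Family n) → lexBoundary n (# F) ≤ boundary F
  edge-isoperimetric {zero} F = z≤n
  edge-isoperimetric {suc n} F = subst (lexBoundary (suc n) (# F) ≤_) (sym (boundary-slices zero F))
    (any-order (slice zero false F) (slice zero true F))
    where
    any-order : (P Q : Family n) → lexBoundary (suc n) (# P + # Q) ≤ boundary P + boundary Q + 2 * # (P Δ Q)
    any-order P Q with ≤-total (# P) (# Q)
    ... | inj₁ P≤Q with m≤n⇒∃[o]m+o≡n (#-≤-+-Δ P Q)
    ...   | s , balance = ≤-trans (m≤m+n (lexBoundary (suc n) (# P + # Q)) (2 * s))
              (lexBoundary-slices-≤ P Q s P≤Q balance (edge-isoperimetric P) (edge-isoperimetric Q))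
    any-order P Q | inj₂ Q≤P with m≤n⇒∃[o]m+o≡n (#-≤-+-Δ Q P)
    ...   | s , balance = subst₂ _≤_ (cong (lexBoundary (suc n)) (+-comm (# Q) (# P)))
              (cong₂ (λ x y → x + 2 * y) (+-comm (boundary Q) (boundary P)) (#-cong (λ A → xor-comm (Q A) (P A))))
              (≤-trans (m≤m+n (lexBoundary (suc n) (# Q + # P)) (2 * s))
                (lexBoundary-slices-≤ Q P s Q≤P balance (edge-isoperimetric Q) (edge-isoperimetric P)))

  -- Monotonization

  _∩_ _∪_ _∖_ : ∀ {n} → Family n → Family n → Family n
  (P ∩ Q) A = P A ∧ Q A
  (P ∪ Q) A = P A ∨ Q A
  (P ∖ Q) A = P A ∧ not (Q A)

  #-∩-∪ : ∀ {n} (P Q : Family n) → # (P ∩ Q) + # (P ∪ Q) ≡ # P + # Q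
  #-∩-∪ P Q = #-+-cong (P ∩ Q) (P ∪ Q) P Q (λ A → pointwise (P A) (Q A))
    where
    pointwise : ∀ p q → ind (p ∧ q) + ind (p ∨ q) ≡ ind p + ind q
    pointwise true true = refl
    pointwise true false = refl
    pointwise false true = refl
    pointwise false false = refl

  ∩-Δ-∪ : ∀ {n} (P Q : Family n) A → ((P ∩ Q) Δ (P ∪ Q)) A ≡ (P Δ Q) A
  ∩-Δ-∪ P Q A with P A | Q A
  ... | true | true = refl
  ... | true | false = refl
  ... | false | true = refl
  ... | false | false = refl

  boundary-∩-∪ : ∀ {n} (P Q : Family n) → boundary (P ∩ Q) + boundary (P ∪ Q) ≤ boundary P + boundary Q
  boundary-∩-∪ P Q =
    subst₂ _≤_ (∑-distrib-+ (boundaryAlong (P ∩ Q)) (boundaryAlong (P ∪ Q))) (∑-distrib-+ (boundaryAlong P) (boundaryAlong Q))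
      (sum-mono (λ j → #-+-mono _ _ _ _ (λ A → submodular (P A) (P (flip j A)) (Q A) (Q (flip j A)))))
    where
    sum-mono : ∀ {n} {f g : Fin n → ℕ} → (∀ j → f j ≤ g j) → sum f ≤ sum g
    sum-mono {zero} f≤g = z≤n
    sum-mono {suc n} f≤g = +-mono-≤ (f≤g zero) (sum-mono (f≤g ∘ suc))
    submodular : ∀ p p' q q' → ind ((p ∧ q) xor (p' ∧ q')) + ind ((p ∨ q) xor (p' ∨ q')) ≤ ind (p xor p') + ind (q xor q')
    submodular true true true true = z≤n
    submodular true true true false = ≤-refl
    submodular true true false true = ≤-refl
    submodular true true false false = z≤n
    submodular true false true true = ≤-refl
    submodular true false true false = ≤-refl
    submodular true false false true = z≤n
    submodular true false false false = ≤-refl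
    submodular false true true true = ≤-refl
    submodular false true true false = z≤n
    submodular false true false true = ≤-refl
    submodular false true false false = ≤-refl
    submodular false false true true = z≤n
    submodular false false true false = ≤-refl
    submodular false false false true = ≤-refl
    submodular false false false false = z≤n

  #-Δ-balance : ∀ {n} (P Q : Family n) → # Q + (# (P ∖ Q) + # (P ∖ Q)) ≡ # P + # (P Δ Q)
  #-Δ-balance {n} P Q = begin
    # Q + (# (P ∖ Q) + # (P ∖ Q))     ≡⟨ +-assoc (# Q) _ _ ⟨
    # Q + # (P ∖ Q) + # (P ∖ Q)       ≡⟨ cong (_+ # (P ∖ Q)) (#-+-cong Q (P ∖ Q) P (Q ∖ P) (λ A → into-P (P A) (Q A))) ⟩
    # P + # (Q ∖ P) + # (P ∖ Q)       ≡⟨ +-assoc (# P) _ _ ⟩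
    # P + (# (Q ∖ P) + # (P ∖ Q))     ≡⟨ cong (# P +_)
                                           (#-+-cong (Q ∖ P) (P ∖ Q) (P Δ Q) (λ _ → false) (λ A → into-Δ (P A) (Q A))) ⟩
    # P + (# (P Δ Q) + # (λ (_ : Set' n) → false)) ≡⟨ cong (λ x → # P + (# (P Δ Q) + x)) (#-empty {n}) ⟩
    # P + (# (P Δ Q) + 0)             ≡⟨ cong (# P +_) (+-identityʳ _) ⟩
    # P + # (P Δ Q)                   ∎
    where
    open ≡-Reasoning
    into-P : ∀ p q → ind q + ind (p ∧ not q) ≡ ind p + ind (q ∧ not p)
    into-P true true = refl
    into-P true false = refl
    into-P false true = refl
    into-P false false = refl
    into-Δ : ∀ p q → ind (q ∧ not p) + ind (p ∧ not q) ≡ ind (p xor q) + ind false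
    into-Δ true true = refl
    into-Δ true false = refl
    into-Δ false true = refl
    into-Δ false false = refl

  module Monotonization {n} (i : Fin (suc n)) (F : Family (suc n)) where

    F⁻ F⁺ : Family n
    F⁻ = slice i false F
    F⁺ = slice i true F

    slice-false : ∀ S → slice i false (S∅ i F) S ≡ (F⁻ ∩ F⁺) S
    slice-false S rewrite insertAt-lookup S i false | insertAt-[]≔ S i false true = refl

    slice-true : ∀ S → slice i true (S∅ i F) S ≡ (F⁻ ∪ F⁺) S
    slice-true S rewrite insertAt-lookup S i true | insertAt-[]≔ S i true false = ∨-comm (F⁺ S) (F⁻ S)

    #-S∅ : # (S∅ i F) ≡ # F
    #-S∅ = begin
      # (S∅ i F)               ≡⟨ sumCube-insertAt i (ind ∘ S∅ i F) ⟩
      # (slice i false (S∅ i F)) + # (slice i true (S∅ i F)) ≡⟨ cong₂ _+_ (#-cong slice-false) (#-cong slice-true) ⟩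
      # (F⁻ ∩ F⁺) + # (F⁻ ∪ F⁺) ≡⟨ #-∩-∪ F⁻ F⁺ ⟩
      # F⁻ + # F⁺              ≡⟨ sumCube-insertAt i (ind ∘ F) ⟨
      # F                      ∎
      where open ≡-Reasoning

    boundary-S∅ : boundary (S∅ i F) ≤ boundary F
    boundary-S∅ = begin
      boundary (S∅ i F)
        ≡⟨ boundary-slices i (S∅ i F) ⟩
      boundary G⁻ + boundary G⁺ + 2 * # (G⁻ Δ G⁺)
        ≡⟨ cong₂ (λ x y → x + y + 2 * # (G⁻ Δ G⁺)) (boundary-cong slice-false) (boundary-cong slice-true) ⟩
      boundary (F⁻ ∩ F⁺) + boundary (F⁻ ∪ F⁺) + 2 * # (G⁻ Δ G⁺)
        ≡⟨ cong (λ x → boundary (F⁻ ∩ F⁺) + boundary (F⁻ ∪ F⁺) + 2 * x)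
                (#-cong (λ S → trans (cong₂ _xor_ (slice-false S) (slice-true S)) (∩-Δ-∪ F⁻ F⁺ S))) ⟩
      boundary (F⁻ ∩ F⁺) + boundary (F⁻ ∪ F⁺) + 2 * # (F⁻ Δ F⁺)
        ≤⟨ +-monoˡ-≤ (2 * # (F⁻ Δ F⁺)) (boundary-∩-∪ F⁻ F⁺) ⟩
      boundary F⁻ + boundary F⁺ + 2 * # (F⁻ Δ F⁺)
        ≡⟨ boundary-slices i F ⟨
      boundary F ∎
      where
      open ≤-Reasoning
      G⁻ = slice i false (S∅ i F)
      G⁺ = slice i true (S∅ i F)

    #-Δ-S∅ : # (F Δ S∅ i F) ≡ # (F⁻ ∖ F⁺) + # (F⁻ ∖ F⁺)
    #-Δ-S∅ = begin
      # (F Δ S∅ i F)                                        ≡⟨ sumCube-insertAt i (ind ∘ (F Δ S∅ i F)) ⟩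
      # (λ S → F⁻ S xor slice i false (S∅ i F) S) + # (λ S → F⁺ S xor slice i true (S∅ i F) S)
        ≡⟨ cong₂ _+_ (#-cong (λ S → cong (F⁻ S xor_) (slice-false S))) (#-cong (λ S → cong (F⁺ S xor_) (slice-true S))) ⟩
      # (F⁻ Δ (F⁻ ∩ F⁺)) + # (F⁺ Δ (F⁻ ∪ F⁺))               ≡⟨ #-+-cong _ _ _ _ (λ S → pointwise (F⁻ S) (F⁺ S)) ⟩
      # (F⁻ ∖ F⁺) + # (F⁻ ∖ F⁺)                             ∎
      where
      open ≡-Reasoning
      pointwise : ∀ p q → ind (p xor (p ∧ q)) + ind (q xor (p ∨ q)) ≡ ind (p ∧ not q) + ind (p ∧ not q)
      pointwise true true = refl
      pointwise true false = refl
      pointwise false true = refl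
      pointwise false false = refl

  boundary-excess-S∅ : ∀ {n} (i : Fin (suc n)) (F : Family (suc n)) → # (slice i false F) ≤ # (slice i true F) →
    lexBoundary (suc n) (# F) + 2 * # (F Δ S∅ i F) ≤ boundary F
  boundary-excess-S∅ {n} i F F⁻≤F⁺ = subst₂ _≤_
    (cong₂ (λ x y → lexBoundary (suc n) x + 2 * y) (sym (sumCube-insertAt i (ind ∘ F))) (sym #-Δ-S∅))
    (sym (boundary-slices i F))
    (lexBoundary-slices-≤ F⁻ F⁺ _ F⁻≤F⁺ (#-Δ-balance F⁻ F⁺) (edge-isoperimetric F⁻) (edge-isoperimetric F⁺))
    where open Monotonization i F

module Scaling where

  open import Data.Nat as ℕ using (ℕ; suc)
  import Data.Nat.Properties as ℕ
  open import Data.Integer as ℤ using (ℤ; +_)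
  import Data.Integer.Properties as ℤ
  open import Data.Integer.Tactic.RingSolver using (solve-∀)
  open import Data.Rational using (ℚ; _/_; _+_; _*_; _≤_; 0ℚ; ½; -_)
  open import Data.Rational.Properties
  open import Data.Rational.Unnormalised as ℚᵘ using (mkℚᵘ; *≡*)
  import Data.Rational.Unnormalised.Properties as ℚᵘ
  open import Data.Empty using (⊥-elim)
  open import Relation.Nullary using (yes; no)

  infix 8 _/1+_
  _/1+_ : ℕ → ℕ → ℚ
  k /1+ d = (+ k) / suc d

  /1+-+ : ∀ d k l → (k ℕ.+ l) /1+ d ≡ k /1+ d + l /1+ d
  /1+-+ d k l = toℚᵘ-injective (ℚᵘ.≃-trans (toℚᵘ-fromℚᵘ (mkℚᵘ (+ (k ℕ.+ l)) d))
     (ℚᵘ.≃-trans sum (ℚᵘ.≃-sym (ℚᵘ.≃-trans (toℚᵘ-homo-+ (k /1+ d) (l /1+ d))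
        (ℚᵘ.+-cong (toℚᵘ-fromℚᵘ (mkℚᵘ (+ k) d)) (toℚᵘ-fromℚᵘ (mkℚᵘ (+ l) d)))))))
    where
    sum : mkℚᵘ (+ (k ℕ.+ l)) d ℚᵘ.≃ (mkℚᵘ (+ k) d ℚᵘ.+ mkℚᵘ (+ l) d)
    sum = *≡* (trans (cong (ℤ._* (+ suc d ℤ.* + suc d)) (ℤ.pos-+ k l)) (cross-multiply (+ k) (+ l) (+ suc d)))
      where
      cross-multiply : ∀ (a b D : ℤ) → (a ℤ.+ b) ℤ.* (D ℤ.* D) ≡ (a ℤ.* D ℤ.+ b ℤ.* D) ℤ.* D
      cross-multiply = solve-∀

  0/1+ : ∀ d → 0 /1+ d ≡ 0ℚ
  0/1+ d = 0/n≡0 (suc d)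

  +-cancelˡ-≤ : ∀ p q r → p + q ≤ p + r → q ≤ r
  +-cancelˡ-≤ p q r p+q≤p+r = subst₂ _≤_ (cancel q) (cancel r) (+-monoʳ-≤ (- p) p+q≤p+r)
    where
    cancel : ∀ x → - p + (p + x) ≡ x
    cancel x = trans (sym (+-assoc (- p) p x)) (trans (cong (_+ x) (+-inverseˡ p)) (+-identityˡ x))

  /1+-mono : ∀ d {k l} → k ℕ.≤ l → k /1+ d ≤ l /1+ d
  /1+-mono d {k} k≤l with ℕ.m≤n⇒∃[o]m+o≡n k≤l
  ... | r , refl = begin
    k /1+ d              ≡⟨ +-identityʳ (k /1+ d) ⟨
    k /1+ d + 0ℚ         ≤⟨ +-monoʳ-≤ (k /1+ d) (nonNegative⁻¹ (r /1+ d) {{normalize-nonNeg r (suc d)}}) ⟩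
    k /1+ d + r /1+ d    ≡⟨ /1+-+ d k r ⟨
    (k ℕ.+ r) /1+ d      ∎
    where open ≤-Reasoning

  /1+-cancel : ∀ d k l → k /1+ d ≤ l /1+ d → k ℕ.≤ l
  /1+-cancel d k l k≤l with k ℕ.≤? l
  ... | yes k≤l = k≤l
  ... | no k≰l with ℕ.m≤n⇒∃[o]m+o≡n (ℕ.≰⇒> k≰l)
  ...   | r , refl = ⊥-elim (<-irrefl refl (begin-strict
    l /1+ d                  ≡⟨ +-identityʳ (l /1+ d) ⟨
    l /1+ d + 0ℚ             <⟨ +-monoʳ-< (l /1+ d) (positive⁻¹ (suc r /1+ d) {{normalize-pos (suc r) (suc d)}}) ⟩
    l /1+ d + suc r /1+ d    ≡⟨ /1+-+ d l (suc r) ⟨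
    (l ℕ.+ suc r) /1+ d      ≡⟨ cong (_/1+ d) (ℕ.+-suc l r) ⟩
    (suc l ℕ.+ r) /1+ d      ≤⟨ k≤l ⟩
    l /1+ d                  ∎))
    where open ≤-Reasoning

  half-of-gap : ∀ d l b k (c : ℚ) → l ℕ.+ 2 ℕ.* k ℕ.≤ b → b /1+ d ≤ l /1+ d + c → k /1+ d ≤ c * ½
  half-of-gap d l b k c gap b≤l+c = subst (_≤ c * ½) (halve (k /1+ d)) (*-monoʳ-≤-nonNeg ½ k+k≤c)
    where
    halve : ∀ p → (p + p) * ½ ≡ p
    halve p = trans (*-distribʳ-+ ½ p p) (trans (sym (*-distribˡ-+ p ½ ½)) (*-identityʳ p))
    k+k≤c : k /1+ d + k /1+ d ≤ c
    k+k≤c = +-cancelˡ-≤ (l /1+ d) _ c (begin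
      l /1+ d + (k /1+ d + k /1+ d)   ≡⟨ cong (λ x → l /1+ d + x) (/1+-+ d k k) ⟨
      l /1+ d + (k ℕ.+ k) /1+ d       ≡⟨ /1+-+ d l (k ℕ.+ k) ⟨
      (l ℕ.+ (k ℕ.+ k)) /1+ d         ≡⟨ cong (λ x → (l ℕ.+ x) /1+ d) (cong (k ℕ.+_) (ℕ.+-identityʳ k)) ⟨
      (l ℕ.+ 2 ℕ.* k) /1+ d           ≤⟨ /1+-mono d gap ⟩
      b /1+ d                         ≤⟨ b≤l+c ⟩
      l /1+ d + c                     ∎)
      where open ≤-Reasoning

module Measures where

  open Combinatorics
  open Scaling
  open import Data.Nat as ℕ using (ℕ; zero; suc; pred; _^_)
  import Data.Nat.Properties as ℕ
  open import Data.Integer using (+_)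
  open import Data.Rational using (_+_)
  open import Data.Rational.Properties using (/-cong)
  open import Data.List.Properties using (foldr-fusion; foldr-map)
  open import Algebra.Properties.CommutativeMonoid.Sum ℕ.+-0-commutativeMonoid using (sum; sum-cong-≗)

  /2^≡/1+ : ∀ k m → k /2^ m ≡ k /1+ pred (2 ^ m)
  /2^≡/1+ k m = /-cong {+ k} {2 ^ m} {+ k} {suc (pred (2 ^ m))} {{ℕ.m^n≢0 2 m}} refl (sym (ℕ.suc-pred (2 ^ m) {{ℕ.m^n≢0 2 m}}))

  foldr-allFin : ∀ n (f : Fin n → ℕ) → foldr (λ j s → f j ℕ.+ s) 0 (allFin n) ≡ sum f
  foldr-allFin zero f = refl
  foldr-allFin (suc n) f = cong (f zero ℕ.+_) (trans (foldr-map _ suc 0 (allFin n)) (foldr-allFin n (f ∘ suc)))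

  μ≡# : ∀ {n} (F : Family n) → μ F ≡ # F /1+ pred (2 ^ n)
  μ≡# {n} F = trans (cong (_/2^ n) (count≡# F)) (/2^≡/1+ (# F) n)

  I≡boundary : ∀ {n} (F : Family n) → I F ≡ boundary F /1+ pred (2 ^ n)
  I≡boundary {n} F = begin
    I F
      ≡⟨ cong (λ e → foldr (λ j q → edges j /2^ n + q) e (allFin n)) (trans (/2^≡/1+ 0 n) (0/1+ (pred (2 ^ n)))) ⟨
    foldr (λ j q → edges j /2^ n + q) (0 /2^ n) (allFin n)
      ≡⟨ foldr-fusion (_/2^ n) 0 (λ j s → /2^-+ (edges j) s) (allFin n) ⟨
    foldr (λ j s → edges j ℕ.+ s) 0 (allFin n) /2^ n
      ≡⟨ cong (_/2^ n) (foldr-allFin n edges) ⟩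
    sum edges /2^ n
      ≡⟨ cong (_/2^ n) (sum-cong-≗ (λ j → count≡# (λ A → F A xor F (flip j A)))) ⟩
    boundary F /2^ n
      ≡⟨ /2^≡/1+ (boundary F) n ⟩
    boundary F /1+ pred (2 ^ n) ∎
    where
    open ≡-Reasoning
    edges : Fin n → ℕ
    edges j = count (λ A → F A xor F (flip j A))
    /2^-+ : ∀ k l → (k ℕ.+ l) /2^ n ≡ k /2^ n + l /2^ n
    /2^-+ k l = trans (/2^≡/1+ (k ℕ.+ l) n) (trans (/1+-+ _ k l) (sym (cong₂ _+_ (/2^≡/1+ k n) (/2^≡/1+ l n))))

  μ⁻≡# : ∀ {m} (i : Fin (suc m)) (F : Family (suc m)) → μ⁻ i F ≡ # (slice i false F) /1+ pred (2 ^ m)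
  μ⁻≡# {m} i F = trans (cong (_/2^ m) (trans (count≡# (λ S → F S ∧ not (lookup S i))) (#-slice-false i F)))
                       (/2^≡/1+ (# (slice i false F)) m)

  μ⁺≡# : ∀ {m} (i : Fin (suc m)) (F : Family (suc m)) → μ⁺ i F ≡ # (slice i true F) /1+ pred (2 ^ m)
  μ⁺≡# {m} i F = trans (cong (_/2^ m) (trans (count≡# (λ S → F S ∧ lookup S i)) (#-slice-true i F)))
                       (/2^≡/1+ (# (slice i true F)) m)

open Combinatorics
open Scaling
open Measures
open import Data.Nat using (ℕ; zero; suc; pred; _^_)
open import Data.Rational using (ℚ; _<_; _≤_; _+_; _*_; 0ℚ; ½)

lemma7p3 : (c₁ : ℚ) → 0ℚ < c₁ → (n : ℕ) → (F : Family n)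
    → (∀ (i : Fin n) → μ⁻ i F ≤ μ⁺ i F)
    → I F ≤ I (Lμ F) + c₁
    → ∀ (i : Fin n) → SmallMod (c₁ * ½) F (S∅ i F)
lemma7p3 c₁ _ zero F _ _ ()
lemma7p3 c₁ _ (suc m) F balanced I-close i =
  trans (μ≡# (S∅ i F)) (trans (cong (_/1+ d) #-S∅) (sym (μ≡# F))) ,
  subst₂ _≤_ (sym (I≡boundary (S∅ i F))) (sym (I≡boundary F)) (/1+-mono d boundary-S∅) ,
  subst (_≤ c₁ * ½) (sym (μ≡# (F Δ S∅ i F)))
    (half-of-gap d (lexBoundary (suc m) (# F)) (boundary F) (# (F Δ S∅ i F)) c₁
      (boundary-excess-S∅ i F F⁻≤F⁺) boundary-close)
  where
  open Monotonization i F
  d = pred (2 ^ suc m)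
  F⁻≤F⁺ : # F⁻ Data.Nat.≤ # F⁺
  F⁻≤F⁺ = /1+-cancel (pred (2 ^ m)) (# F⁻) (# F⁺) (subst₂ _≤_ (μ⁻≡# i F) (μ⁺≡# i F) (balanced i))
  boundary-close : boundary F /1+ d ≤ lexBoundary (suc m) (# F) /1+ d + c₁
  boundary-close = subst₂ (λ x y → x ≤ y + c₁) (I≡boundary F)
    (trans (I≡boundary (Lμ F)) (cong (_/1+ d) (boundary-Lμ F))) I-close
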